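{- Let $k_1<k_2\le 3$ be positive integers and $\mathbf{x}\in\Sigma_q^*$. Suppose that $T_{i_2,k_2}\circ T_{i_1,k_1}(\mathbf{x})=\mathbf{x}'$ for some nonnegative integers $i_1,i_2$. Then there exist integers $3\ge \ell_1\ge\ell_2\ge\cdots\ge\ell_t\ge 1$ and nonnegative integers $j_1,\dots,j_t$ such that $T_{j_t,\ell_t}\circ T_{j_{t-1},\ell_{t-1}}\circ\cdots\circ T_{j_1,\ell_1}(\mathbf{x})=\mathbf{x}'$.
   Context: $\Sigma_q=\{0,\dots,q-1\}$ with $q\ge2$; $\Sigma_q^*$ is the set of finite words over $\Sigma_q$. For integers $k\ge1$, $i\ge0$ with $i+k\le|\mathbf{x}|$, the tandem duplication $T_{i,k}$ maps $\mathbf{x}=\mathbf{u}\mathbf{v}\mathbf{w}$ with $|\mathbf{u}|=i$, $|\mathbf{v}|=k$ to $\mathbf{u}\mathbf{v}\mathbf{v}\mathbf{w}$. -}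

module Defs where

open import Data.Nat using (ℕ; _≤_; _≥_; _+_)
open import Data.Fin using (Fin)
open import Data.List using (List; []; _∷_; _++_; length)
open import Data.Product using (_×_; _,_; Σ; ∃)
open import Relation.Binary.PropositionalEquality using (_≡_)

Word : ℕ → Set
Word q = List (Fin q)

-- Tandem duplication T_{i,k} as a (partial) function, rendered as a relation:
-- TD i k x y  means  k ≥ 1, i + k ≤ |x| (implied by the decomposition) and
-- x = u v w with |u| = i, |v| = k, y = u v v w.
record TD {q : ℕ} (i k : ℕ) (x y : Word q) : Set where
  constructor td
  field
    k≥1 : k ≥ 1
    u v w : Word q
    len-u : length u ≡ i
    len-v : length v ≡ k
    x≡ : x ≡ u ++ v ++ w
    y≡ : y ≡ u ++ v ++ v ++ w

-- Applying the sequence of duplications (ℓ₁,j₁),…,(ℓ_t,j_t) in order: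
-- Apply [(ℓ₁,j₁),…,(ℓ_t,j_t)] x y  means  T_{j_t,ℓ_t} ∘ ⋯ ∘ T_{j₁,ℓ₁}(x) = y
-- (each step defined).
data Apply {q : ℕ} : List (ℕ × ℕ) → Word q → Word q → Set where
  done : ∀ {x} → Apply [] x x
  step : ∀ {ℓ j ops x y z} → TD j ℓ x y → Apply ops y z → Apply ((ℓ , j) ∷ ops) x z

data Bounded≥ : List (ℕ × ℕ) → Set where
  []  : Bounded≥ []
  [_] : ∀ {ℓ j} → 1 ≤ ℓ × ℓ ≤ 3 → Bounded≥ ((ℓ , j) ∷ [])
  _∷_ : ∀ {ℓ j ℓ' j' ops} → 1 ≤ ℓ × ℓ ≤ 3 → ℓ ≥ ℓ' →
        Bounded≥ ((ℓ' , j') ∷ ops) → Bounded≥ ((ℓ , j) ∷ (ℓ' , j') ∷ ops)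

module Submission where

-- Write x = u v w, x₁ = u v v w = a b c and x' = a b b c with |v| = k₁ and
-- |b| = k₂.  After stripping the common prefix of u and a, one of them is
-- empty, and there are two kinds of configurations.
--   * The block b lies entirely to the right of the first copy of v
--     (u = [], |v| ≤ |a|) or entirely inside the prefix u v (a = [],
--     |b| ≤ |u v|).  Then b already occurs in x, and the two duplications
--     commute: duplicate b first, then v (lemmas swap-right, swap-left).
--   * Otherwise b straddles the freshly created copy of v.  Since
--     |v| < |b| ≤ 3 only five shapes of (u, v, a, b) are possible; in each
--     x' is reached by three explicit duplications of lengths 2,2,1 or
--     2,1,1 or 1,1,1 (lemmas straddle-left, straddle-right).
-- Prepending a common letter to x and x' shifts all positions by one and
-- preserves reachability (lift-Reach), which handles the common prefix.

open import Defs
open import Data.Bool using (Bool; true; T; _∧_)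
open import Data.Bool.Properties using (T-∧)
open import Data.Nat using (ℕ; _<_; _≤_; _≥_; _≤ᵇ_; suc; z≤n; s≤s; _≤?_)
open import Data.Nat.Properties using (≤-trans; <⇒≤; ≤ᵇ⇒≤; ≰⇒>)
open import Data.Fin using (Fin)
open import Data.List using (List; []; _∷_; _++_; length)
open import Data.List.Properties using (∷-injective; ++-assoc; length-++-≤ʳ)
open import Data.Product using (_×_; Σ; _,_)
open import Function.Bundles using (Equivalence)
open import Relation.Nullary using (yes; no; ¬_; contradiction)
open import Relation.Binary.PropositionalEquality
  using (_≡_; refl; sym; trans; cong; subst; subst₂)

module _ {A : Set} where

  split-++ : (v w a r : List A) → v ++ w ≡ a ++ r → length v ≤ length a →
             Σ (List A) (λ t → a ≡ v ++ t × w ≡ t ++ r)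
  split-++ []      w a       r eq _         = a , refl , eq
  split-++ (x ∷ v) w (y ∷ a) r eq (s≤s |v|≤|a|)
    with refl , eq′ ← ∷-injective eq
    with t , refl , w≡ ← split-++ v w a r eq′ |v|≤|a| = t , refl , w≡

  regroup : (a b c d : List A) → a ++ b ≡ c ++ d → ∀ z → a ++ b ++ z ≡ c ++ d ++ z
  regroup a b c d eq z =
    trans (sym (++-assoc a b z)) (trans (cong (_++ z) eq) (++-assoc c d z))

  nonempty : (u : List A) (p : A) (v : List A) → 1 ≤ length (u ++ p ∷ v)
  nonempty u p v = ≤-trans (s≤s z≤n) (length-++-≤ʳ (p ∷ v) {u})

-- A boolean test for the shape condition 3 ≥ ℓ₁ ≥ ⋯ ≥ ℓ_t ≥ 1; it lets the
-- condition be discharged by evaluation on concrete sequences.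
bounded? : List (ℕ × ℕ) → Bool
bounded? []                             = true
bounded? ((ℓ , _) ∷ [])                 = (1 ≤ᵇ ℓ) ∧ (ℓ ≤ᵇ 3)
bounded? ((ℓ , _) ∷ (ℓ′ , j′) ∷ ops) =
  (1 ≤ᵇ ℓ) ∧ ((ℓ ≤ᵇ 3) ∧ ((ℓ′ ≤ᵇ ℓ) ∧ bounded? ((ℓ′ , j′) ∷ ops)))

split-∧ : ∀ {x y} → T (x ∧ y) → T x × T y
split-∧ = Equivalence.to T-∧

bounded?-sound : ∀ ops → T (bounded? ops) → Bounded≥ ops
bounded?-sound []                          _ = []
bounded?-sound ((ℓ , _) ∷ [])              h =
  let 1≤ℓ , ℓ≤3 = split-∧ h in [ ≤ᵇ⇒≤ 1 ℓ 1≤ℓ , ≤ᵇ⇒≤ ℓ 3 ℓ≤3 ]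
bounded?-sound ((ℓ , _) ∷ (ℓ′ , j′) ∷ ops) h =
  let 1≤ℓ , h₁ = split-∧ h; ℓ≤3 , h₂ = split-∧ h₁; ℓ′≤ℓ , rest = split-∧ h₂
  in _∷_ (≤ᵇ⇒≤ 1 ℓ 1≤ℓ , ≤ᵇ⇒≤ ℓ 3 ℓ≤3) (≤ᵇ⇒≤ ℓ′ ℓ ℓ′≤ℓ) (bounded?-sound ((ℓ′ , j′) ∷ ops) rest)

module _ {q : ℕ} where
  private
    W = Word q

  Reach : W → W → Set
  Reach x x′ = Σ (List (ℕ × ℕ)) (λ ops → Bounded≥ ops × Apply ops x x′)

  dup : (u v w : W) → 1 ≤ length v →
        TD (length u) (length v) (u ++ v ++ w) (u ++ v ++ v ++ w)
  dup u v w 1≤|v| = td 1≤|v| u v w refl refl refl refl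

  reach-by-test : ∀ {ops x x′} → Apply ops x x′ → {T (bounded? ops)} → Reach x x′
  reach-by-test {ops} run {ok} = ops , bounded?-sound ops ok , run

  reach₂ : ∀ {ℓ ℓ′ j j′ x y z} → TD j ℓ x y → TD j′ ℓ′ y z → ℓ′ ≤ ℓ → ℓ ≤ 3 → Reach x z
  reach₂ {ℓ} {ℓ′} {j} {j′} first second ℓ′≤ℓ ℓ≤3 =
    (ℓ , j) ∷ (ℓ′ , j′) ∷ [] ,
    _∷_ (≤-trans 1≤ℓ′ ℓ′≤ℓ , ℓ≤3) ℓ′≤ℓ [ 1≤ℓ′ , ≤-trans ℓ′≤ℓ ℓ≤3 ] ,
    step first (step second done)
    where
    1≤ℓ′ : 1 ≤ ℓ′
    1≤ℓ′ = TD.k≥1 second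

  shift : List (ℕ × ℕ) → List (ℕ × ℕ)
  shift []              = []
  shift ((ℓ , j) ∷ ops) = (ℓ , suc j) ∷ shift ops

  shift-bounded : ∀ {ops} → Bounded≥ ops → Bounded≥ (shift ops)
  shift-bounded []                       = []
  shift-bounded [ bounds ]               = [ bounds ]
  shift-bounded (_∷_ bounds ℓ′≤ℓ rest) = _∷_ bounds ℓ′≤ℓ (shift-bounded rest)

  lift-TD : ∀ {j ℓ x y} (h : Fin q) → TD j ℓ x y → TD (suc j) ℓ (h ∷ x) (h ∷ y)
  lift-TD h (td 1≤ℓ u v w |u| |v| x≡ y≡) =
    td 1≤ℓ (h ∷ u) v w (cong suc |u|) |v| (cong (h ∷_) x≡) (cong (h ∷_) y≡)

  lift-Apply : ∀ {ops x y} (h : Fin q) → Apply ops x y → Apply (shift ops) (h ∷ x) (h ∷ y)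
  lift-Apply h done         = done
  lift-Apply h (step d run) = step (lift-TD h d) (lift-Apply h run)

  lift-Reach : ∀ {x x′} (h : Fin q) → Reach x x′ → Reach (h ∷ x) (h ∷ x′)
  lift-Reach h (ops , bounded , run) = shift ops , shift-bounded bounded , lift-Apply h run

  -- u = [] and the block b lies to the right of the first copy of v
  -- (a = v t): then x = t b c, so duplicate b there first, then v at the front.
  swap-right : (v w a b c : W) → v ++ v ++ w ≡ a ++ b ++ c → length v ≤ length a →
               1 ≤ length v → length v ≤ length b → length b ≤ 3 →
               Reach (v ++ w) (a ++ b ++ b ++ c)
  swap-right v w a b c eq |v|≤|a| 1≤|v| |v|≤|b| |b|≤3
    with t , refl , vw≡tbc ← split-++ v (v ++ w) a (b ++ c) eq |v|≤|a|
    with s , tb≡vs , _ ← split-++ v w (t ++ b) c (trans vw≡tbc (sym (++-assoc t b c)))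
                                  (≤-trans |v|≤|b| (length-++-≤ʳ b {t}))
    = subst₂ Reach (sym vw≡tbc) (sym (++-assoc v t (b ++ b ++ c)))
        (reach₂ (dup t b c (≤-trans 1≤|v| |v|≤|b|)) dup-v |v|≤|b| |b|≤3)
    where
    shifted : t ++ b ++ b ++ c ≡ v ++ s ++ b ++ c
    shifted = regroup t b v s tb≡vs (b ++ c)
    dup-v : TD 0 (length v) (t ++ b ++ b ++ c) (v ++ t ++ b ++ b ++ c)
    dup-v = subst₂ (TD 0 (length v)) (sym shifted) (cong (v ++_) (sym shifted))
                   (dup [] v (s ++ b ++ c) 1≤|v|)

  -- a = [] and the block b is a prefix of u v (u v = b t): duplicate b at the
  -- front of x = b t w, then v behind b u.
  swap-left : (u v w b c : W) → u ++ v ++ v ++ w ≡ b ++ c → length b ≤ length (u ++ v) →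
              1 ≤ length v → length v ≤ length b → length b ≤ 3 →
              Reach (u ++ v ++ w) (b ++ b ++ c)
  swap-left u v w b c eq |b|≤|uv| 1≤|v| |v|≤|b| |b|≤3
    with t , uv≡bt , refl ← split-++ b c (u ++ v) (v ++ w)
                                     (trans (sym eq) (sym (++-assoc u v (v ++ w)))) |b|≤|uv|
    = reach₂ dup-b dup-v |v|≤|b| |b|≤3
    where
    after : ∀ z → (b ++ u) ++ v ++ z ≡ b ++ b ++ t ++ z
    after z = trans (++-assoc b u (v ++ z)) (cong (b ++_) (regroup u v b t uv≡bt z))
    dup-b : TD 0 (length b) (u ++ v ++ w) (b ++ b ++ t ++ w)
    dup-b = subst (λ x → TD 0 (length b) x (b ++ b ++ t ++ w))
                  (sym (regroup u v b t uv≡bt w)) (dup [] b (t ++ w) (≤-trans 1≤|v| |v|≤|b|))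
    dup-v : TD (length (b ++ u)) (length v) (b ++ b ++ t ++ w) (b ++ b ++ t ++ v ++ w)
    dup-v = subst₂ (TD (length (b ++ u)) (length v)) (after w) (after (v ++ w))
                   (dup (b ++ u) v w 1≤|v|)

  -- u = [] and b straddles the end of the first copy of v (|a| < |v|).
  -- The four shapes, with x ↦ x' realised by three duplications:
  --   v = p,    b = p p   :  p w     ↦ p p w ↦ p p p w ↦ p p p p w
  --   v = p,    b = p p t :  p t c   ↦ p t p t c ↦ p p t p t c ↦ p p t p p t c
  --   v = p p', a = [],   and   v = p p', a = p :  lengths 2, 2, 1.
  -- Every other combination of lengths violates |a| < |v| < |b| ≤ 3.
  straddle-left : (v w a b c : W) → length a < length v → length v < length b →
                  length b ≤ 3 → v ++ v ++ w ≡ a ++ b ++ c → Reach (v ++ w) (a ++ b ++ b ++ c)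
  straddle-left (p ∷ []) w [] (_ ∷ _ ∷ []) c _ _ _ refl =
    reach-by-test (step (dup [] (p ∷ []) w (s≤s z≤n))
                  (step (dup [] (p ∷ []) (p ∷ w) (s≤s z≤n))
                  (step (dup [] (p ∷ []) (p ∷ p ∷ w) (s≤s z≤n)) done)))
  straddle-left (p ∷ []) (t ∷ c) [] (_ ∷ _ ∷ _ ∷ []) c _ _ _ refl =
    reach-by-test (step (dup [] (p ∷ t ∷ []) c (s≤s z≤n))
                  (step (dup [] (p ∷ []) (t ∷ p ∷ t ∷ c) (s≤s z≤n))
                  (step (dup (p ∷ p ∷ t ∷ []) (p ∷ []) (t ∷ c) (s≤s z≤n)) done)))
  straddle-left (p ∷ p′ ∷ []) w [] (_ ∷ _ ∷ _ ∷ []) _ _ _ _ refl =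
    reach-by-test (step (dup [] (p ∷ p′ ∷ []) w (s≤s z≤n))
                  (step (dup (p ∷ []) (p′ ∷ p ∷ []) (p′ ∷ w) (s≤s z≤n))
                  (step (dup (p ∷ p′ ∷ []) (p ∷ []) (p′ ∷ p ∷ p′ ∷ w) (s≤s z≤n)) done)))
  straddle-left (p ∷ p′ ∷ []) w (_ ∷ []) (_ ∷ _ ∷ _ ∷ []) _ _ _ _ refl =
    reach-by-test (step (dup [] (p ∷ p′ ∷ []) w (s≤s z≤n))
                  (step (dup (p ∷ []) (p′ ∷ p ∷ []) (p′ ∷ w) (s≤s z≤n))
                  (step (dup (p ∷ p′ ∷ p ∷ []) (p′ ∷ []) (p ∷ p′ ∷ w) (s≤s z≤n)) done)))
  straddle-left []                    _ _ _ _ () _ _ _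
  straddle-left (_ ∷ [])              _ (_ ∷ _) _ _ (s≤s ()) _ _ _
  straddle-left (_ ∷ _ ∷ [])          _ (_ ∷ _ ∷ _) _ _ (s≤s (s≤s ())) _ _ _
  straddle-left (_ ∷ _ ∷ _ ∷ _)       _ _ (_ ∷ _ ∷ _ ∷ []) _ _ (s≤s (s≤s (s≤s ()))) _ _
  straddle-left _ _ _ []                  _ _ () _ _
  straddle-left (_ ∷ _) _ _ (_ ∷ [])      _ _ (s≤s ()) _ _
  straddle-left _ _ _ (_ ∷ _ ∷ _ ∷ _ ∷ _) _ _ _ (s≤s (s≤s (s≤s ()))) _
  straddle-left (_ ∷ _ ∷ _) _ _ (_ ∷ _ ∷ []) _ _ (s≤s (s≤s ())) _ _

  -- a = [] and b reaches past the end of u v; the only possible shape is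
  -- u = h, v = p, b = h p p:  h p w ↦ h p h p w ↦ h p p h p w ↦ h p p h p p w.
  straddle-right : (u v w b c : W) → 1 ≤ length u → 1 ≤ length v → length v < length b →
                   length b ≤ 3 → ¬ (length b ≤ length (u ++ v)) →
                   u ++ v ++ v ++ w ≡ b ++ c → Reach (u ++ v ++ w) (b ++ b ++ c)
  straddle-right (h ∷ []) (p ∷ []) w (_ ∷ _ ∷ _ ∷ []) _ _ _ _ _ _ refl =
    reach-by-test (step (dup [] (h ∷ p ∷ []) w (s≤s z≤n))
                  (step (dup (h ∷ []) (p ∷ []) (h ∷ p ∷ w) (s≤s z≤n))
                  (step (dup (h ∷ p ∷ p ∷ h ∷ []) (p ∷ []) w (s≤s z≤n)) done)))
  straddle-right [] _ _ _ _ () _ _ _ _ _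
  straddle-right (_ ∷ _) [] _ _ _ _ () _ _ _ _
  straddle-right (_ ∷ _) (_ ∷ _) _ [] _ _ _ () _ _ _
  straddle-right (_ ∷ _) (_ ∷ _) _ (_ ∷ []) _ _ _ (s≤s ()) _ _ _
  straddle-right (_ ∷ _) (_ ∷ _) _ (_ ∷ _ ∷ _ ∷ _ ∷ _) _ _ _ _ (s≤s (s≤s (s≤s ()))) _ _
  straddle-right (_ ∷ u) (p ∷ v) _ (_ ∷ _ ∷ []) _ _ _ _ _ short _ =
    contradiction (s≤s (nonempty u p v)) short
  straddle-right (_ ∷ _ ∷ u) (p ∷ v) _ (_ ∷ _ ∷ _ ∷ []) _ _ _ _ _ short _ =
    contradiction (s≤s (s≤s (nonempty u p v))) short
  straddle-right (_ ∷ []) (_ ∷ _ ∷ _) _ (_ ∷ _ ∷ _ ∷ []) _ _ _ _ _ short _ =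
    contradiction (s≤s (s≤s (s≤s z≤n))) short

  two-duplications : (u v w a b c : W) → 1 ≤ length v → length v < length b →
                     length b ≤ 3 → u ++ v ++ v ++ w ≡ a ++ b ++ c →
                     Reach (u ++ v ++ w) (a ++ b ++ b ++ c)
  two-duplications (h ∷ u) v w (h′ ∷ a) b c 1≤|v| |v|<|b| |b|≤3 eq
    with refl , eq′ ← ∷-injective eq =
    lift-Reach h (two-duplications u v w a b c 1≤|v| |v|<|b| |b|≤3 eq′)
  two-duplications [] v w a b c 1≤|v| |v|<|b| |b|≤3 eq with length v ≤? length a
  ... | yes |v|≤|a| = swap-right v w a b c eq |v|≤|a| 1≤|v| (<⇒≤ |v|<|b|) |b|≤3
  ... | no  |v|≰|a| = straddle-left v w a b c (≰⇒> |v|≰|a|) |v|<|b| |b|≤3 eq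
  two-duplications (h ∷ u) v w [] b c 1≤|v| |v|<|b| |b|≤3 eq
    with length b ≤? length (h ∷ u ++ v)
  ... | yes |b|≤|uv| = swap-left (h ∷ u) v w b c eq |b|≤|uv| 1≤|v| (<⇒≤ |v|<|b|) |b|≤3
  ... | no  |b|≰|uv| = straddle-right (h ∷ u) v w b c (s≤s z≤n) 1≤|v| |v|<|b| |b|≤3 |b|≰|uv| eq

lemma5 : (q : ℕ) → q ≥ 2 → (k₁ k₂ i₁ i₂ : ℕ) → 1 ≤ k₁ → k₁ < k₂ → k₂ ≤ 3 →
    (x x₁ x' : Word q) → TD i₁ k₁ x x₁ → TD i₂ k₂ x₁ x' →
    Σ (List (ℕ × ℕ)) (λ ops → Bounded≥ ops × Apply ops x x')
lemma5 q _ k₁ k₂ i₁ i₂ 1≤k₁ k₁<k₂ k₂≤3 x x₁ x'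
       (td _ u v w _ refl refl refl) (td _ a b c _ refl x₁≡abc refl) =
  two-duplications u v w a b c 1≤k₁ k₁<k₂ k₂≤3 x₁≡abc
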